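{- Let $m$ be a positive integer. Every $2^m(2^{m+1}+1)^{m+2}$-$T_0T^\ast$-perfect number $n>1$ has the form $n=p_1^{2^{m+1}(2^{m+1}+1)^{m+2}-1}$ or $n=p_1\cdots p_{m+2}$, where $p_1,\dots,p_{m+2}$ are distinct primes.
   Context: $T(M)$ denotes the product of all positive divisors of $M$. A divisor $d$ of $M$ is unitary if $\gcd(d,M/d)=1$, and $T^\ast(M)$ denotes the product of all unitary divisors of $M$. For an integer $K\ge 2$, an integer $n>1$ is called $K$-$T_0T^\ast$-perfect if $T(T^\ast(n))=n^K$. -}

module Defs where

open import Data.Nat using (ℕ; zero; suc; _*_; _/_; _^_; _≟_; _>_)
open import Data.Nat.Divisibility using (_∣?_)
open import Data.Nat.GCD using (gcd)
open import Data.List using (List; applyUpTo; filter; map)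
open import Data.Nat.ListAction using (product)
open import Relation.Nullary.Decidable using (_×-dec_)
open import Data.Product using (_×_)
open import Relation.Binary.PropositionalEquality using (_≡_)

divisors : ℕ → List ℕ
divisors M = filter (λ d → d ∣? M) (applyUpTo suc M)

T : ℕ → ℕ
T M = product (divisors M)

unitaryDivisors : ℕ → List ℕ
unitaryDivisors M =
  map suc (filter (λ k → (suc k ∣? M) ×-dec (gcd (suc k) (M / suc k) ≟ 1)) (applyUpTo (λ k → k) M))

T* : ℕ → ℕ
T* M = product (unitaryDivisors M)

IsKT₀T*Perfect : ℕ → ℕ → Set
IsKT₀T*Perfect K n = (n > 1) × (T (T* n) ≡ n ^ K)

-- Write n = ∏ pᵢ ^ aᵢ with s distinct primes. Divisors, and likewise unitary divisors, of M pair up as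
-- d ↔ M / d, so T(M)² = M ^ d(M); as n has 2 ^ s unitary divisors, T*(n) = n ^ 2ˢ⁻¹. Hence T(T*(n)) = n ^ K
-- forces 2K = 2ˢ⁻¹ ∏ (1 + aᵢ 2ˢ⁻¹). For K = 2ᵐ (2ᵐ⁺¹ + 1)ᵐ⁺² and s = 1 this reads a₁ + 1 = 2K. For s ≥ 2
-- the product is odd, so comparing powers of 2 gives s = m + 2 and ∏ (1 + aᵢ B) = (1 + B)ˢ with B = 2ᵐ⁺¹;
-- since every factor is at least 1 + B, all aᵢ = 1.

module Submission where

open import Defs
open import Data.Empty using (⊥-elim)
open import Data.Fin using (Fin; zero; suc)
open import Data.List using (List; []; _∷_; map; length; applyUpTo; upTo; cartesianProduct)
open import Data.List.Membership.Propositional using (_∈_)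
open import Data.List.Membership.Propositional.Properties
  using (∈-map⁺; ∈-map⁻; ∈-filter⁺; ∈-filter⁻; ∈-map∘filter⁺; ∈-map∘filter⁻; ∈-applyUpTo⁺
        ; ∈-upTo⁺; ∈-upTo⁻; ∈-tabulate⁺; ∈-cartesianProduct⁺; ∈-cartesianProduct⁻)
open import Data.List.Membership.Propositional.Properties.WithK using (unique∧set⇒bag)
open import Data.List.Properties using (length-map; length-++; length-upTo)
open import Data.List.Relation.Binary.BagAndSetEquality using (∼bag⇒↭)
open import Data.List.Relation.Binary.Permutation.Propositional using (_↭_)
open import Data.List.Relation.Binary.Permutation.Propositional.Properties using (↭-length)
open import Data.List.Relation.Unary.All as All using (All; []; _∷_)
import Data.List.Relation.Unary.All.Properties as All
open import Data.List.Relation.Unary.Any using (here; there)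
open import Data.List.Relation.Unary.Unique.Propositional using (Unique; []; _∷_)
import Data.List.Relation.Unary.Unique.Propositional.Properties as Unique
open import Data.Nat
open import Data.Nat.Coprimality as Coprime
  using (Coprime; coprime-divisor; gcd≡1⇒coprime; coprime⇒gcd≡1; 1-coprimeTo)
open import Data.Nat.Divisibility
open import Data.Nat.DivMod using (m*[n/m]≡n; m*n/n≡m; /-congˡ)
open import Data.Nat.GCD using (gcd; gcd[m,n]∣m; gcd[m,n]∣n; gcd-greatest; c*gcd[m,n]≡gcd[cm,cn])
open import Data.Nat.Induction using (<-rec)
open import Data.Nat.ListAction using (product)
open import Data.Nat.ListAction.Properties using (product-↭; ∈⇒∣product)
open import Data.Nat.Primality
  using (Prime; prime[2]; prime⇒irreducible; prime⇒nonZero; prime⇒nonTrivial; euclidsLemma)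
open import Data.Nat.Primality.Factorisation using (factorise)
open import Data.Nat.Properties
open import Data.Product using (Σ; ∃₂; ∃-syntax; _×_; _,_; proj₁; proj₂; uncurry)
open import Data.Product.Properties using (×-≡,≡→≡)
open import Data.Sum using (_⊎_; inj₁; inj₂; [_,_]′)
open import Data.Unit using (⊤; tt)
import Data.Vec.Functional as Vec
open import Data.Vec.Functional using (toList)
open import Function using (_∘_; id; mk⇔)
open import Function.Definitions using (Injective)
open import Relation.Binary.Definitions using (tri<; tri≈; tri>)
open import Relation.Binary.PropositionalEquality
open import Relation.Nullary using (¬_; Dec; yes; no; contradiction)
open import Relation.Nullary.Decidable using (_×-dec_)

-- Arithmetic of natural numbers

0∤ : ∀ {M} .{{_ : NonZero M}} → ¬ 0 ∣ M
0∤ {M} 0∣M = ≢-nonZero⁻¹ M (0∣⇒≡0 0∣M)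

n≡d*r⇒r<n×r≢0 : ∀ {n d r} .{{_ : NonZero n}} → 1 < d → n ≡ d * r → r < n × NonZero r
n≡d*r⇒r<n×r≢0 {n} {d} {zero}  _   n≡d*0 = ⊥-elim (≢-nonZero⁻¹ n (trans n≡d*0 (*-zeroʳ d)))
n≡d*r⇒r<n×r≢0 {d = d} {suc r} 1<d refl  = subst (suc r <_) (*-comm (suc r) d) (m<m*n (suc r) d 1<d) , _

square-injective : ∀ {m n} → m * m ≡ n * n → m ≡ n
square-injective {m} {n} eq with <-cmp m n
... | tri< m<n _ _ = contradiction eq (<⇒≢ (*-mono-< m<n m<n))
... | tri≈ _ m≡n _ = m≡n
... | tri> _ _ m>n = contradiction (sym eq) (<⇒≢ (*-mono-< m>n m>n))

^-injectiveʳ : ∀ {p i j} → 1 < p → p ^ i ≡ p ^ j → i ≡ j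
^-injectiveʳ {p} {i} {j} 1<p eq with <-cmp i j
... | tri< i<j _ _ = contradiction eq (<⇒≢ (^-monoʳ-< p 1<p i<j))
... | tri≈ _ i≡j _ = i≡j
... | tri> _ _ i>j = contradiction (sym eq) (<⇒≢ (^-monoʳ-< p 1<p i>j))

^-distribʳ-* : ∀ m n k → (m * n) ^ k ≡ m ^ k * n ^ k
^-distribʳ-* m n zero    = refl
^-distribʳ-* m n (suc k) =
  trans (cong (m * n *_) (^-distribʳ-* m n k)) ([m*n]*[o*p]≡[m*o]*[n*p] m n (m ^ k) (n ^ k))

^-monoʳ-∣ : ∀ p {i j} → i ≤ j → p ^ i ∣ p ^ j
^-monoʳ-∣ p {i} {j} i≤j =
  divides (p ^ (j ∸ i)) (trans (cong (p ^_) (sym (m∸n+n≡m i≤j))) (^-distribˡ-+-* p (j ∸ i) i))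

m∣m^n : ∀ m {n} → 1 ≤ n → m ∣ m ^ n
m∣m^n m {n} 1≤n = subst (_∣ m ^ n) (^-identityʳ m) (^-monoʳ-∣ m 1≤n)

2^m*x+2^m*x≡2^[m+1]*x : ∀ m x → 2 ^ m * x + 2 ^ m * x ≡ 2 ^ (m + 1) * x
2^m*x+2^m*x≡2^[m+1]*x m x = trans (sym (*-distribʳ-+ x (2 ^ m) (2 ^ m)))
  (cong (_* x) (sym (trans (cong (2 ^_) (+-comm m 1)) (cong (2 ^ m +_) (+-identityʳ (2 ^ m))))))

[1+B]^length≤∏[1+a*B] : ∀ B as → All (1 ≤_) as → (1 + B) ^ length as ≤ product (map (λ a → 1 + a * B) as)
[1+B]^length≤∏[1+a*B] B []       []          = ≤-refl
[1+B]^length≤∏[1+a*B] B (a ∷ as) (1≤a ∷ 1≤as) =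
  *-mono-≤ (s≤s (subst (_≤ a * B) (*-identityˡ B) (*-monoˡ-≤ B 1≤a))) ([1+B]^length≤∏[1+a*B] B as 1≤as)

-- Each factor 1 + a * B is at least 1 + B, strictly so unless a = 1.
∏[1+a*B]≡[1+B]^length⇒a≡1 : ∀ B as → 1 ≤ B → All (1 ≤_) as →
  product (map (λ a → 1 + a * B) as) ≡ (1 + B) ^ length as → All (_≡ 1) as
∏[1+a*B]≡[1+B]^length⇒a≡1 B []                 _   _            _  = []
∏[1+a*B]≡[1+B]^length⇒a≡1 B (1 ∷ as)           1≤B (_ ∷ 1≤as)   eq = refl ∷
  ∏[1+a*B]≡[1+B]^length⇒a≡1 B as 1≤B 1≤as (*-cancelˡ-≡ _ _ (1 + B)
    (subst (λ b → (1 + b) * product (map (λ a → 1 + a * B) as) ≡ (1 + B) ^ length (1 ∷ as))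
      (*-identityˡ B) eq))
∏[1+a*B]≡[1+B]^length⇒a≡1 B (suc (suc a) ∷ as) 1≤B (_ ∷ 1≤as)   eq = contradiction (sym eq) (<⇒≢ (begin-strict
  (1 + B) * (1 + B) ^ length as
    <⟨ *-monoˡ-< ((1 + B) ^ length as) {{m^n≢0 (1 + B) (length as)}} 1+B<1+[2+a]*B ⟩
  (1 + (2 + a) * B) * (1 + B) ^ length as
    ≤⟨ *-monoʳ-≤ (1 + (2 + a) * B) ([1+B]^length≤∏[1+a*B] B as 1≤as) ⟩
  (1 + (2 + a) * B) * product (map (λ a → 1 + a * B) as) ∎))
  where
  open ≤-Reasoning
  1+B<1+[2+a]*B : 1 + B < 1 + (2 + a) * B
  1+B<1+[2+a]*B = s≤s (subst (B <_) (*-comm B (2 + a)) (m<m*n B (2 + a) {{>-nonZero 1≤B}} (s≤s (s≤s z≤n))))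

-- Primes and coprimality

prime⇒1< : ∀ {p} → Prime p → 1 < p
prime⇒1< {p} p-prime = nonTrivial⇒n>1 p {{prime⇒nonTrivial p-prime}}

prime∤1 : ∀ {p} → Prime p → ¬ p ∣ 1
prime∤1 p-prime p∣1 = >⇒≢ (prime⇒1< p-prime) (∣1⇒≡1 p∣1)

prime∤* : ∀ {p m n} → Prime p → ¬ p ∣ m → ¬ p ∣ n → ¬ p ∣ m * n
prime∤* {m = m} {n} p-prime p∤m p∤n = [ p∤m , p∤n ]′ ∘ euclidsLemma m n p-prime

prime∤product : ∀ {p ns} → Prime p → All (λ n → ¬ p ∣ n) ns → ¬ p ∣ product ns
prime∤product p-prime []           = prime∤1 p-prime
prime∤product p-prime (p∤n ∷ p∤ns) = prime∤* p-prime p∤n (prime∤product p-prime p∤ns)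

prime∤^ : ∀ {p n} → Prime p → ¬ p ∣ n → ∀ k → ¬ p ∣ n ^ k
prime∤^ p-prime p∤n zero    = prime∤1 p-prime
prime∤^ p-prime p∤n (suc k) = prime∤* p-prime p∤n (prime∤^ p-prime p∤n k)

∣m⇒∤1+m : ∀ {d m} → 1 < d → d ∣ m → ¬ d ∣ 1 + m
∣m⇒∤1+m {d} {m} 1<d d∣m d∣1+m = >⇒≢ 1<d (∣1⇒≡1 (∣m+n∣m⇒∣n (subst (d ∣_) (+-comm 1 m) d∣1+m) d∣m))

p^i*u≡p^j*v⇒i≡j×u≡v : ∀ {p} .{{_ : NonZero p}} i j {u v} → ¬ p ∣ u → ¬ p ∣ v →
                      p ^ i * u ≡ p ^ j * v → i ≡ j × u ≡ v
p^i*u≡p^j*v⇒i≡j×u≡v         zero    zero    {u} {v} _   _   eq = refl , *-cancelˡ-≡ u v 1 eq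
p^i*u≡p^j*v⇒i≡j×u≡v {p}     zero    (suc j) {u} {v} p∤u _   eq =
  ⊥-elim (p∤u (subst (p ∣_) (trans (sym eq) (*-identityˡ u)) (∣m⇒∣m*n v (m∣m*n (p ^ j)))))
p^i*u≡p^j*v⇒i≡j×u≡v {p}     (suc i) zero    {u} {v} _   p∤v eq =
  ⊥-elim (p∤v (subst (p ∣_) (trans eq (*-identityˡ v)) (∣m⇒∣m*n u (m∣m*n (p ^ i)))))
p^i*u≡p^j*v⇒i≡j×u≡v {p}     (suc i) (suc j) {u} {v} p∤u p∤v eq
  with i≡j , u≡v ← p^i*u≡p^j*v⇒i≡j×u≡v i j p∤u p∤v
                     (*-cancelˡ-≡ _ _ p (trans (sym (*-assoc p (p ^ i) u)) (trans eq (*-assoc p (p ^ j) v))))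
  = cong suc i≡j , u≡v

coprime-∣ : ∀ {a b x y} → Coprime a b → x ∣ a → y ∣ b → Coprime x y
coprime-∣ coprime x∣a y∣b (i∣x , i∣y) = coprime (∣-trans i∣x x∣a , ∣-trans i∣y y∣b)

coprime-*ˡ : ∀ {x y z} → Coprime x z → Coprime y z → Coprime (x * y) z
coprime-*ˡ {x} {y} {z} x⊥z y⊥z {i} (i∣xy , i∣z) = x⊥z (i∣x , i∣z)
  where
  i∣x : i ∣ x
  i∣x = coprime-divisor (λ (j∣i , j∣y) → y⊥z (j∣y , ∣-trans j∣i i∣z)) (subst (i ∣_) (*-comm x y) i∣xy)

coprime-*ʳ : ∀ {x y z} → Coprime z x → Coprime z y → Coprime z (x * y)
coprime-*ʳ z⊥x z⊥y = Coprime.sym (coprime-*ˡ (Coprime.sym z⊥x) (Coprime.sym z⊥y))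

coprime-^ˡ : ∀ {x y} i → Coprime x y → Coprime (x ^ i) y
coprime-^ˡ {y = y} zero    _   = 1-coprimeTo y
coprime-^ˡ         (suc i) x⊥y = coprime-*ˡ x⊥y (coprime-^ˡ i x⊥y)

coprime-^ : ∀ {x y} i j → Coprime x y → Coprime (x ^ i) (y ^ j)
coprime-^ i j x⊥y = coprime-^ˡ i (Coprime.sym (coprime-^ˡ j (Coprime.sym x⊥y)))

prime∤⇒coprime : ∀ {p n} → Prime p → ¬ p ∣ n → Coprime p n
prime∤⇒coprime p-prime p∤n (i∣p , i∣n) with prime⇒irreducible p-prime i∣p
... | inj₁ i≡1 = i≡1
... | inj₂ refl = ⊥-elim (p∤n i∣n)

coprime⇒*∣ : ∀ {m n x} → Coprime m n → m ∣ x → n ∣ x → m * n ∣ x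
coprime⇒*∣ {m} {n} m⊥n (divides q refl) n∣qm
  with divides r refl ← coprime-divisor (Coprime.sym m⊥n) (subst (n ∣_) (*-comm q m) n∣qm) =
  divides r (trans (*-assoc r n m) (cong (r *_) (*-comm n m)))

coprime-split : ∀ {a b d} → Coprime a b → d ∣ a * b → ∃₂ λ x y → x ∣ a × y ∣ b × d ≡ x * y
coprime-split {a} {b} {d} a⊥b d∣ab = gcd d a , gcd d b , gcd[m,n]∣n d a , gcd[m,n]∣n d b ,
  ∣-antisym d∣product product∣d
  where
  d∣gcd[d,a]*b : d ∣ gcd d a * b
  d∣gcd[d,a]*b = subst (d ∣_) (trans (sym (c*gcd[m,n]≡gcd[cm,cn] b d a)) (*-comm b _))
    (gcd-greatest (n∣m*n b) (subst (d ∣_) (*-comm a b) d∣ab))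
  d∣product : d ∣ gcd d a * gcd d b
  d∣product = subst (d ∣_) (sym (c*gcd[m,n]≡gcd[cm,cn] (gcd d a) d b))
    (gcd-greatest (n∣m*n (gcd d a)) d∣gcd[d,a]*b)
  product∣d : gcd d a * gcd d b ∣ d
  product∣d = coprime⇒*∣ (coprime-∣ a⊥b (gcd[m,n]∣n d a) (gcd[m,n]∣n d b)) (gcd[m,n]∣m d a) (gcd[m,n]∣m d b)

coprime-*-injective : ∀ {a b x y x′ y′} .{{_ : NonZero a}} → Coprime a b →
                      x ∣ a → y ∣ b → x′ ∣ a → y′ ∣ b → x * y ≡ x′ * y′ → x ≡ x′ × y ≡ y′
coprime-*-injective {x = x} {y} {x′} {y′} a⊥b x∣a y∣b x′∣a y′∣b eq = x≡x′ , y≡y′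
  where
  x≡x′ : x ≡ x′
  x≡x′ = ∣-antisym
    (coprime-divisor (coprime-∣ a⊥b x∣a y′∣b) (subst (x ∣_) (trans eq (*-comm x′ y′)) (m∣m*n y)))
    (coprime-divisor (coprime-∣ a⊥b x′∣a y∣b) (subst (x′ ∣_) (trans (sym eq) (*-comm x y)) (m∣m*n y′)))
  y≡y′ : y ≡ y′
  y≡y′ = *-cancelˡ-≡ y y′ x {{≢-nonZero (λ x≡0 → 0∤ (subst (_∣ _) x≡0 x∣a))}}
    (trans eq (cong (_* y′) (sym x≡x′)))

∣prime^⇒≡prime^ : ∀ {p d} → Prime p → ∀ a → d ∣ p ^ a → ∃[ i ] i ≤ a × d ≡ p ^ i
∣prime^⇒≡prime^ _ zero d∣1 = 0 , z≤n , ∣1⇒≡1 d∣1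
∣prime^⇒≡prime^ {p} {d} p-prime (suc a) d∣p^1+a with p ∣? d
... | yes (divides q refl)
  with i , i≤a , refl ← ∣prime^⇒≡prime^ {d = q} p-prime a
         (*-cancelʳ-∣ p {{prime⇒nonZero p-prime}} (subst (q * p ∣_) (*-comm p (p ^ a)) d∣p^1+a))
  = suc i , s≤s i≤a , *-comm (p ^ i) p
... | no p∤d
  with i , i≤a , d≡p^i ← ∣prime^⇒≡prime^ p-prime a
         (coprime-divisor (Coprime.sym (prime∤⇒coprime p-prime p∤d)) d∣p^1+a)
  = i , m≤n⇒m≤1+n i≤a , d≡p^i

-- Duplicate-free lists enumerating a predicate

record Enumerates {A : Set} (P : A → Set) (xs : List A) : Set where
  field
    unique     : Unique xs
    sound      : ∀ {x} → x ∈ xs → P x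
    exhaustive : ∀ {x} → P x → x ∈ xs

open Enumerates

enumerates-↭ : ∀ {A : Set} {P : A → Set} {xs ys} → Enumerates P xs → Enumerates P ys → xs ↭ ys
enumerates-↭ exs eys = ∼bag⇒↭ (unique∧set⇒bag (unique exs) (unique eys)
  (mk⇔ (exhaustive eys ∘ sound exs) (exhaustive exs ∘ sound eys)))

enumerates-length : ∀ {A : Set} {P : A → Set} {xs ys} → Enumerates P xs → Enumerates P ys →
                    length xs ≡ length ys
enumerates-length exs eys = ↭-length (enumerates-↭ exs eys)

unique-map⁺ : ∀ {A B : Set} {f : A → B} {xs} →
              (∀ {x y} → x ∈ xs → y ∈ xs → f x ≡ f y → x ≡ y) → Unique xs → Unique (map f xs)
unique-map⁺ inj [] = []
unique-map⁺ inj (x≢xs ∷ u) =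
  All.map⁺ (All.tabulate λ y∈xs fx≡fy → All.lookup x≢xs y∈xs (inj (here refl) (there y∈xs) fx≡fy))
  ∷ unique-map⁺ (λ x∈ y∈ → inj (there x∈) (there y∈)) u

map-involution-↭ : ∀ {P : ℕ → Set} {xs} (f : ℕ → ℕ) → Enumerates P xs →
                   (∀ {x} → P x → P (f x)) → (∀ {x} → P x → f (f x) ≡ x) → map f xs ↭ xs
map-involution-↭ {P} {xs} f e closed involutive = enumerates-↭ image e
  where
  image : Enumerates P (map f xs)
  image .unique = unique-map⁺ (λ x∈ y∈ fx≡fy →
    trans (sym (involutive (sound e x∈))) (trans (cong f fx≡fy) (involutive (sound e y∈)))) (unique e)
  image .sound z∈ with _ , x∈ , refl ← ∈-map⁻ f z∈ = closed (sound e x∈)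
  image .exhaustive pz = subst (_∈ map f xs) (involutive pz) (∈-map⁺ f (exhaustive e (closed pz)))

product*product-map : ∀ (f : ℕ → ℕ) {M} xs → (∀ {x} → x ∈ xs → x * f x ≡ M) →
                      product xs * product (map f xs) ≡ M ^ length xs
product*product-map f []       _      = refl
product*product-map f {M} (x ∷ xs) x*fx≡M = begin
  (x * product xs) * (f x * product (map f xs)) ≡⟨ [m*n]*[o*p]≡[m*o]*[n*p] x _ (f x) _ ⟩
  (x * f x) * (product xs * product (map f xs)) ≡⟨ cong₂ _*_ (x*fx≡M (here refl))
                                                     (product*product-map f xs (x*fx≡M ∘ there)) ⟩
  M * M ^ length xs                             ∎
  where open ≡-Reasoning

product-squared : ∀ {P : ℕ → Set} {M xs} (f : ℕ → ℕ) → Enumerates P xs →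
                  (∀ {x} → P x → P (f x)) → (∀ {x} → P x → f (f x) ≡ x) → (∀ {x} → P x → x * f x ≡ M) →
                  product xs * product xs ≡ M ^ length xs
product-squared {M = M} {xs} f e closed involutive x*fx≡M = begin
  product xs * product xs         ≡⟨ cong (product xs *_) (product-↭ (map-involution-↭ f e closed involutive)) ⟨
  product xs * product (map f xs) ≡⟨ product*product-map f xs (x*fx≡M ∘ sound e) ⟩
  M ^ length xs                   ∎
  where open ≡-Reasoning

length-cartesianProduct : ∀ {A B : Set} (xs : List A) (ys : List B) →
                          length (cartesianProduct xs ys) ≡ length xs * length ys
length-cartesianProduct []       ys = refl
length-cartesianProduct (x ∷ xs) ys = trans (length-++ (map (x ,_) ys))
  (cong₂ _+_ (length-map (x ,_) ys) (length-cartesianProduct xs ys))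

length-enumerates-* : ∀ {P Q R : ℕ → Set} {xs ys zs} →
  Enumerates P xs → Enumerates Q ys → Enumerates R zs →
  (∀ {x y x′ y′} → P x → Q y → P x′ → Q y′ → x * y ≡ x′ * y′ → x ≡ x′ × y ≡ y′) →
  (∀ {x y} → P x → Q y → R (x * y)) →
  (∀ {z} → R z → ∃₂ λ x y → P x × Q y × z ≡ x * y) →
  length zs ≡ length xs * length ys
length-enumerates-* {P} {Q} {R} {xs} {ys} {zs} exs eys ezs injective closed split = begin
  length zs                                           ≡⟨ enumerates-length ezs products ⟩
  length (map (uncurry _*_) (cartesianProduct xs ys)) ≡⟨ length-map _ (cartesianProduct xs ys) ⟩
  length (cartesianProduct xs ys)                     ≡⟨ length-cartesianProduct xs ys ⟩
  length xs * length ys                               ∎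
  where
  open ≡-Reasoning
  pair : ∀ {u} → u ∈ cartesianProduct xs ys → P (proj₁ u) × Q (proj₂ u)
  pair u∈ with x∈ , y∈ ← ∈-cartesianProduct⁻ xs ys u∈ = sound exs x∈ , sound eys y∈
  products : Enumerates R (map (uncurry _*_) (cartesianProduct xs ys))
  products .unique = unique-map⁺ (λ u∈ v∈ eq → let px , qy = pair u∈; px′ , qy′ = pair v∈ in
    ×-≡,≡→≡ (injective px qy px′ qy′ eq)) (Unique.cartesianProduct⁺ (unique exs) (unique eys))
  products .sound z∈ with _ , u∈ , refl ← ∈-map⁻ (uncurry _*_) z∈ = uncurry closed (pair u∈)
  products .exhaustive rz with _ , _ , px , qy , refl ← split rz =
    ∈-map⁺ (uncurry _*_) (∈-cartesianProduct⁺ (exhaustive exs px) (exhaustive eys qy))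

-- Divisors and unitary divisors

-- M / d, made total by the junk value 0 at d = 0 so that it can be mapped over a list.
cofactor : ℕ → ℕ → ℕ
cofactor M zero    = 0
cofactor M (suc k) = M / suc k

*-cofactor : ∀ {M d} .{{_ : NonZero M}} → d ∣ M → d * cofactor M d ≡ M
*-cofactor {d = zero}  0∣M = ⊥-elim (0∤ 0∣M)
*-cofactor {d = suc _} d∣M = m*[n/m]≡n d∣M

cofactor-∣ : ∀ {M d} .{{_ : NonZero M}} → d ∣ M → cofactor M d ∣ M
cofactor-∣ {d = d} d∣M = divides d (sym (*-cofactor d∣M))

cofactor-unique : ∀ {M} x {y} .{{_ : NonZero M}} → x * y ≡ M → cofactor M x ≡ y
cofactor-unique {M} zero        eq   = ⊥-elim (≢-nonZero⁻¹ M (sym eq))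
cofactor-unique (suc k) {y}     refl = trans (/-congˡ (*-comm (suc k) y)) (m*n/n≡m y (suc k))

cofactor-involutive : ∀ {M d} .{{_ : NonZero M}} → d ∣ M → cofactor M (cofactor M d) ≡ d
cofactor-involutive {M} {d} d∣M = cofactor-unique (cofactor M d) (trans (*-comm _ d) (*-cofactor d∣M))

cofactor-* : ∀ {a b x y} .{{_ : NonZero a}} .{{_ : NonZero b}} → x ∣ a → y ∣ b →
             cofactor (a * b) (x * y) ≡ cofactor a x * cofactor b y
cofactor-* {a} {b} {x} {y} x∣a y∣b = cofactor-unique (x * y) {{m*n≢0 a b}}
  (trans ([m*n]*[o*p]≡[m*o]*[n*p] x y (cofactor a x) (cofactor b y))
         (cong₂ _*_ (*-cofactor x∣a) (*-cofactor y∣b)))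

divisors-enumerates : ∀ {M} .{{_ : NonZero M}} → Enumerates (_∣ M) (divisors M)
divisors-enumerates {M} .unique =
  Unique.filter⁺ (_∣? M) (Unique.applyUpTo⁺₁ suc M (λ i<j _ → <⇒≢ i<j ∘ suc-injective))
divisors-enumerates {M} .sound d∈ = proj₂ (∈-filter⁻ (_∣? M) {xs = applyUpTo suc M} d∈)
divisors-enumerates {M} .exhaustive {zero}  0∣M = ⊥-elim (0∤ 0∣M)
divisors-enumerates {M} .exhaustive {suc k} d∣M = ∈-filter⁺ (_∣? M) (∈-applyUpTo⁺ suc (∣⇒≤ d∣M)) d∣M

T-squared : ∀ M .{{_ : NonZero M}} → T M * T M ≡ M ^ length (divisors M)
T-squared M = product-squared (cofactor M) divisors-enumerates cofactor-∣ cofactor-involutive *-cofactor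

IsUnitaryDivisor : ℕ → ℕ → Set
IsUnitaryDivisor M d = d ∣ M × Coprime d (cofactor M d)

unitaryDivisors-enumerates : ∀ {M} .{{_ : NonZero M}} → Enumerates (IsUnitaryDivisor M) (unitaryDivisors M)
unitaryDivisors-enumerates {M} = record
  { unique     = Unique.map⁺ suc-injective
                   (Unique.filter⁺ unitary? (Unique.applyUpTo⁺₁ id M (λ i<j _ → <⇒≢ i<j)))
  ; sound      = sound′
  ; exhaustive = exhaustive′
  }
  where
  unitary? : ∀ k → Dec (suc k ∣ M × gcd (suc k) (M / suc k) ≡ 1)
  unitary? k = (suc k ∣? M) ×-dec (gcd (suc k) (M / suc k) ≟ 1)
  sound′ : ∀ {d} → d ∈ unitaryDivisors M → IsUnitaryDivisor M d
  sound′ d∈ with _ , _ , refl , d∣M , gcd≡1 ← ∈-map∘filter⁻ suc unitary? {xs = applyUpTo id M} d∈ =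
    d∣M , gcd≡1⇒coprime gcd≡1
  exhaustive′ : ∀ {d} → IsUnitaryDivisor M d → d ∈ unitaryDivisors M
  exhaustive′ {zero}  (0∣M , _)       = ⊥-elim (0∤ 0∣M)
  exhaustive′ {suc k} (d∣M , coprime) = ∈-map∘filter⁺ suc unitary? {xs = applyUpTo id M}
    (k , ∈-applyUpTo⁺ id (∣⇒≤ d∣M) , refl , d∣M , coprime⇒gcd≡1 coprime)

T*-squared : ∀ M .{{_ : NonZero M}} → T* M * T* M ≡ M ^ length (unitaryDivisors M)
T*-squared M = product-squared (cofactor M) unitaryDivisors-enumerates closed
  (cofactor-involutive ∘ proj₁) (*-cofactor ∘ proj₁)
  where
  closed : ∀ {d} → IsUnitaryDivisor M d → IsUnitaryDivisor M (cofactor M d)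
  closed (d∣M , coprime) = cofactor-∣ d∣M ,
    subst (Coprime _) (sym (cofactor-involutive d∣M)) (Coprime.sym coprime)

T*≡^ : ∀ M .{{_ : NonZero M}} e → length (unitaryDivisors M) ≡ 2 * e → T* M ≡ M ^ e
T*≡^ M e len = square-injective (begin
  T* M * T* M                    ≡⟨ T*-squared M ⟩
  M ^ length (unitaryDivisors M) ≡⟨ cong (M ^_) (trans len (cong (e +_) (+-identityʳ e))) ⟩
  M ^ (e + e)                    ≡⟨ ^-distribˡ-+-* M e e ⟩
  M ^ e * M ^ e                  ∎)
  where open ≡-Reasoning

length-divisors-* : ∀ {a b} .{{_ : NonZero a}} .{{_ : NonZero b}} → Coprime a b →
                    length (divisors (a * b)) ≡ length (divisors a) * length (divisors b)
length-divisors-* {a} {b} a⊥b = length-enumerates-* divisors-enumerates divisors-enumerates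
  (divisors-enumerates {{m*n≢0 a b}})
  (coprime-*-injective a⊥b) *-pres-∣ (coprime-split a⊥b)

length-unitaryDivisors-* : ∀ {a b} .{{_ : NonZero a}} .{{_ : NonZero b}} → Coprime a b →
  length (unitaryDivisors (a * b)) ≡ length (unitaryDivisors a) * length (unitaryDivisors b)
length-unitaryDivisors-* {a} {b} a⊥b = length-enumerates-* unitaryDivisors-enumerates unitaryDivisors-enumerates
  (unitaryDivisors-enumerates {{m*n≢0 a b}})
  (λ px qy px′ qy′ → coprime-*-injective a⊥b (proj₁ px) (proj₁ qy) (proj₁ px′) (proj₁ qy′)) closed split
  where
  closed : ∀ {x y} → IsUnitaryDivisor a x → IsUnitaryDivisor b y → IsUnitaryDivisor (a * b) (x * y)
  closed {x} {y} (x∣a , x⊥x̄) (y∣b , y⊥ȳ) = *-pres-∣ x∣a y∣b ,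
    subst (Coprime (x * y)) (sym (cofactor-* x∣a y∣b))
      (coprime-*ˡ (coprime-*ʳ x⊥x̄ (coprime-∣ a⊥b x∣a (cofactor-∣ y∣b)))
                  (coprime-*ʳ (coprime-∣ (Coprime.sym a⊥b) y∣b (cofactor-∣ x∣a)) y⊥ȳ))
  split : ∀ {z} → IsUnitaryDivisor (a * b) z →
          ∃₂ λ x y → IsUnitaryDivisor a x × IsUnitaryDivisor b y × z ≡ x * y
  split (z∣ab , z⊥z̄) with x , y , x∣a , y∣b , refl ← coprime-split a⊥b z∣ab =
    x , y , (x∣a , coprime-∣ xy⊥x̄ȳ (m∣m*n y) (m∣m*n (cofactor b y))) ,
      (y∣b , coprime-∣ xy⊥x̄ȳ (n∣m*n x) (n∣m*n (cofactor a x))) , refl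
    where
    xy⊥x̄ȳ : Coprime (x * y) (cofactor a x * cofactor b y)
    xy⊥x̄ȳ = subst (Coprime _) (cofactor-* x∣a y∣b) z⊥z̄

length-divisors-prime^ : ∀ {p} → Prime p → ∀ a → length (divisors (p ^ a)) ≡ suc a
length-divisors-prime^ {p} p-prime a = begin
  length (divisors (p ^ a))          ≡⟨ enumerates-length (divisors-enumerates {{p^a≢0}}) powers ⟩
  length (map (p ^_) (upTo (suc a))) ≡⟨ length-map (p ^_) (upTo (suc a)) ⟩
  length (upTo (suc a))              ≡⟨ length-upTo (suc a) ⟩
  suc a                              ∎
  where
  open ≡-Reasoning
  p^a≢0 : NonZero (p ^ a)
  p^a≢0 = m^n≢0 p a {{prime⇒nonZero p-prime}}
  powers : Enumerates (_∣ p ^ a) (map (p ^_) (upTo (suc a)))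
  powers .unique = Unique.map⁺ (^-injectiveʳ (prime⇒1< p-prime)) (Unique.upTo⁺ (suc a))
  powers .sound d∈ with i , i∈ , refl ← ∈-map⁻ (p ^_) d∈ = ^-monoʳ-∣ p (s≤s⁻¹ (∈-upTo⁻ i∈))
  powers .exhaustive d∣p^a with i , i≤a , refl ← ∣prime^⇒≡prime^ p-prime a d∣p^a =
    ∈-map⁺ (p ^_) (∈-upTo⁺ (s≤s i≤a))

-- Only 1 and p ^ a: any other p ^ i shares the factor p with its cofactor p ^ (a ∸ i).
length-unitaryDivisors-prime^ : ∀ {p} → Prime p → ∀ {a} → 1 ≤ a → length (unitaryDivisors (p ^ a)) ≡ 2
length-unitaryDivisors-prime^ {p} p-prime {a} 1≤a =
  enumerates-length (unitaryDivisors-enumerates {{p^a≢0}}) trivial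
  where
  p^a≢0 : NonZero (p ^ a)
  p^a≢0 = m^n≢0 p a {{prime⇒nonZero p-prime}}
  trivial : Enumerates (IsUnitaryDivisor (p ^ a)) (1 ∷ p ^ a ∷ [])
  trivial .unique = (<⇒≢ (^-monoʳ-< p (prime⇒1< p-prime) 1≤a) ∷ []) ∷ [] ∷ []
  trivial .sound (here refl) = 1∣ _ , 1-coprimeTo _
  trivial .sound (there (here refl)) = ∣-refl ,
    subst (Coprime (p ^ a)) (sym (cofactor-unique (p ^ a) {{p^a≢0}} (*-identityʳ (p ^ a))))
      (Coprime.sym (1-coprimeTo _))
  trivial .exhaustive (d∣p^a , coprime) with ∣prime^⇒≡prime^ p-prime a d∣p^a
  ... | zero , _ , refl = here refl
  ... | suc i , i<a , refl with suc i ≟ a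
  ...   | yes refl = there (here refl)
  ...   | no 1+i≢a = contradiction
    (coprime (m∣m*n (p ^ i) , subst (p ∣_) (sym cofactor≡) (m∣m^n p (m<n⇒0<n∸m (≤∧≢⇒< i<a 1+i≢a)))))
    (>⇒≢ (prime⇒1< p-prime))
    where
    cofactor≡ : cofactor (p ^ a) (p ^ suc i) ≡ p ^ (a ∸ suc i)
    cofactor≡ = cofactor-unique (p ^ suc i) {{p^a≢0}}
      (trans (sym (^-distribˡ-+-* p (suc i) (a ∸ suc i))) (cong (p ^_) (m+[n∸m]≡n i<a)))

-- Canonical factorisations

expand : List (ℕ × ℕ) → ℕ
expand F = product (map (uncurry _^_) F)

exponents : List (ℕ × ℕ) → List ℕ
exponents = map proj₂

Canonical : List (ℕ × ℕ) → Set
Canonical []            = ⊤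
Canonical ((p , a) ∷ F) = Prime p × 1 ≤ a × ¬ p ∣ expand F × Canonical F

canonical⇒exponents≥1 : ∀ F → Canonical F → All (1 ≤_) (exponents F)
canonical⇒exponents≥1 []            _                       = []
canonical⇒exponents≥1 ((p , a) ∷ F) (_ , 1≤a , _ , canon) = 1≤a ∷ canonical⇒exponents≥1 F canon

expand-nonZero : ∀ F → Canonical F → NonZero (expand F)
expand-nonZero []            _                         = _
expand-nonZero ((p , a) ∷ F) (p-prime , _ , _ , canon) =
  m*n≢0 (p ^ a) (expand F) {{m^n≢0 p a {{prime⇒nonZero p-prime}}}} {{expand-nonZero F canon}}

∃-prime-divisor : ∀ {n} → 1 < n → ∃[ p ] Prime p × p ∣ n
∃-prime-divisor {1} (s≤s ())
∃-prime-divisor {suc (suc k)} _ with factorise (2 + k)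
... | record { factors = [] ; isFactorisation = () }
... | record { factors = p ∷ ps ; isFactorisation = eq ; factorsPrime = p-prime ∷ _ } =
  p , p-prime , subst (p ∣_) (sym eq) (m∣m*n (product ps))

split-power : ∀ {p} → 1 < p → ∀ n .{{_ : NonZero n}} → ∃₂ λ a r → n ≡ p ^ a * r × ¬ p ∣ r
split-power {p} 1<p = <-rec _ go
  where
  go : ∀ n → (∀ {m} → m < n → .{{_ : NonZero m}} → ∃₂ λ a r → m ≡ p ^ a * r × ¬ p ∣ r) →
       .{{_ : NonZero n}} → ∃₂ λ a r → n ≡ p ^ a * r × ¬ p ∣ r
  go n rec with p ∣? n
  ... | no p∤n = 0 , n , sym (*-identityˡ n) , p∤n
  ... | yes (divides q refl)
    with a , r , refl , p∤r ← rec (m<m*n q p {{m*n≢0⇒m≢0 q}} 1<p) {{m*n≢0⇒m≢0 q}}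
    = suc a , r , trans (*-comm _ p) (sym (*-assoc p (p ^ a) r)) , p∤r

canonicalFactorisation : ∀ n .{{_ : NonZero n}} → ∃[ F ] Canonical F × expand F ≡ n
canonicalFactorisation = <-rec _ go
  where
  go : ∀ n → (∀ {m} → m < n → .{{_ : NonZero m}} → ∃[ F ] Canonical F × expand F ≡ m) →
       .{{_ : NonZero n}} → ∃[ F ] Canonical F × expand F ≡ n
  go 1                 _   = [] , tt , refl
  go n@(suc (suc k)) rec
    with p , p-prime , p∣n ← ∃-prime-divisor {n} (s≤s (s≤s z≤n))
    with split-power (prime⇒1< p-prime) n
  ... | zero , r , n≡r , p∤r = ⊥-elim (p∤r (subst (p ∣_) (trans n≡r (*-identityˡ r)) p∣n))
  ... | suc a , r , n≡p^[1+a]*r , p∤r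
    with r<n , r≢0 ← n≡d*r⇒r<n×r≢0 (^-monoʳ-< p (prime⇒1< p-prime) {0} {suc a} (s≤s z≤n)) n≡p^[1+a]*r
    with F , canon , refl ← rec r<n {{r≢0}}
    = (p , suc a) ∷ F , (p-prime , s≤s z≤n , p∤r , canon) , sym n≡p^[1+a]*r

length-unitaryDivisors-expand : ∀ F → Canonical F → length (unitaryDivisors (expand F)) ≡ 2 ^ length F
length-unitaryDivisors-expand []            _                             = refl
length-unitaryDivisors-expand ((p , a) ∷ F) (p-prime , 1≤a , p∤F , canon) = begin
  length (unitaryDivisors (p ^ a * expand F))
    ≡⟨ length-unitaryDivisors-* {{m^n≢0 p a {{prime⇒nonZero p-prime}}}} {{expand-nonZero F canon}}
         (coprime-^ˡ a (prime∤⇒coprime p-prime p∤F)) ⟩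
  length (unitaryDivisors (p ^ a)) * length (unitaryDivisors (expand F))
    ≡⟨ cong₂ _*_ (length-unitaryDivisors-prime^ p-prime 1≤a) (length-unitaryDivisors-expand F canon) ⟩
  2 * 2 ^ length F ∎
  where open ≡-Reasoning

length-divisors-expand^ : ∀ k F → Canonical F →
                          length (divisors (expand F ^ k)) ≡ product (map (λ a → 1 + a * k) (exponents F))
length-divisors-expand^ k []            _                           = cong (length ∘ divisors) (^-zeroˡ k)
length-divisors-expand^ k ((p , a) ∷ F) (p-prime , _ , p∤F , canon) = begin
  length (divisors ((p ^ a * expand F) ^ k))
    ≡⟨ cong (length ∘ divisors)
         (trans (^-distribʳ-* (p ^ a) (expand F) k) (cong (_* expand F ^ k) (^-*-assoc p a k))) ⟩
  length (divisors (p ^ (a * k) * expand F ^ k))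
    ≡⟨ length-divisors-* {{m^n≢0 p (a * k) {{prime⇒nonZero p-prime}}}}
                         {{m^n≢0 (expand F) k {{expand-nonZero F canon}}}}
         (coprime-^ (a * k) k (prime∤⇒coprime p-prime p∤F)) ⟩
  length (divisors (p ^ (a * k))) * length (divisors (expand F ^ k))
    ≡⟨ cong₂ _*_ (length-divisors-prime^ p-prime (a * k)) (length-divisors-expand^ k F canon) ⟩
  (1 + a * k) * product (map (λ a → 1 + a * k) (exponents F)) ∎
  where open ≡-Reasoning

DistinctPrimeProduct : ℕ → ℕ → Set
DistinctPrimeProduct k n =
  Σ (Fin k → ℕ) λ p → ((i : Fin k) → Prime (p i)) × Injective _≡_ _≡_ p × n ≡ product (toList p)

∷-distinctPrimeProduct : ∀ {p k n} → Prime p → ¬ p ∣ n → DistinctPrimeProduct k n →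
                         DistinctPrimeProduct (suc k) (p * n)
∷-distinctPrimeProduct {p} {k} {n} p-prime p∤n (q , q-prime , q-injective , n≡∏q) =
  p Vec.∷ q , prime , injective , cong (p *_) n≡∏q
  where
  q∣n : ∀ i → q i ∣ n
  q∣n i = subst (q i ∣_) (sym n≡∏q) (∈⇒∣product (∈-tabulate⁺ i))
  prime : ∀ i → Prime ((p Vec.∷ q) i)
  prime zero    = p-prime
  prime (suc i) = q-prime i
  injective : Injective _≡_ _≡_ (p Vec.∷ q)
  injective {zero}  {zero}  _     = refl
  injective {zero}  {suc j} p≡qj  = ⊥-elim (p∤n (subst (_∣ n) (sym p≡qj) (q∣n j)))
  injective {suc i} {zero}  qi≡p  = ⊥-elim (p∤n (subst (_∣ n) qi≡p (q∣n i)))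
  injective {suc i} {suc j} qi≡qj = cong suc (q-injective qi≡qj)

expand-distinctPrimeProduct : ∀ F → Canonical F → All (_≡ 1) (exponents F) →
                              DistinctPrimeProduct (length F) (expand F)
expand-distinctPrimeProduct []            _ _ = (λ ()) , (λ ()) , (λ { {()} }) , refl
expand-distinctPrimeProduct ((p , 1) ∷ F) (p-prime , _ , p∤F , canon) (refl ∷ ones) =
  subst (λ p′ → DistinctPrimeProduct (suc (length F)) (p′ * expand F)) (sym (^-identityʳ p))
    (∷-distinctPrimeProduct p-prime p∤F (expand-distinctPrimeProduct F canon ones))

-- T₀T*-perfect numbers

-- With n = p ^ a * ∏ pᵢ ^ aᵢ (t further primes), T*(n) = n ^ 2ᵗ and T(n ^ 2ᵗ)² = n ^ (2ᵗ · d(n ^ 2ᵗ)).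
exponent-identity : ∀ {K p a} F → Canonical ((p , a) ∷ F) → IsKT₀T*Perfect K (expand ((p , a) ∷ F)) →
  K + K ≡ 2 ^ length F * product (map (λ b → 1 + b * 2 ^ length F) (a ∷ exponents F))
exponent-identity {K} {p} {a} F canon (1<n , perfect) = ^-injectiveʳ 1<n (begin
  n ^ (K + K)                         ≡⟨ ^-distribˡ-+-* n K K ⟩
  n ^ K * n ^ K                       ≡⟨ cong₂ _*_ perfect′ perfect′ ⟨
  T (n ^ e) * T (n ^ e)               ≡⟨ T-squared (n ^ e) {{m^n≢0 n e}} ⟩
  (n ^ e) ^ length (divisors (n ^ e)) ≡⟨ cong ((n ^ e) ^_) (length-divisors-expand^ e ((p , a) ∷ F) canon) ⟩
  (n ^ e) ^ D                         ≡⟨ ^-*-assoc n e D ⟩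
  n ^ (e * D)                         ∎)
  where
  open ≡-Reasoning
  n = expand ((p , a) ∷ F)
  e = 2 ^ length F
  D = product (map (λ b → 1 + b * e) (a ∷ exponents F))
  instance
    n≢0 : NonZero n
    n≢0 = expand-nonZero ((p , a) ∷ F) canon
  perfect′ : T (n ^ e) ≡ n ^ K
  perfect′ = trans (cong T (sym (T*≡^ n e (length-unitaryDivisors-expand ((p , a) ∷ F) canon)))) perfect

perfect⇒exponent-identity : ∀ m {p a} F → Canonical ((p , a) ∷ F) →
  IsKT₀T*Perfect (2 ^ m * (2 ^ (m + 1) + 1) ^ (m + 2)) (expand ((p , a) ∷ F)) →
  2 ^ (m + 1) * (2 ^ (m + 1) + 1) ^ (m + 2) ≡
    2 ^ length F * product (map (λ b → 1 + b * 2 ^ length F) (a ∷ exponents F))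
perfect⇒exponent-identity m F canon perfect = trans (sym (2^m*x+2^m*x≡2^[m+1]*x m _))
  (exponent-identity {K = 2 ^ m * (2 ^ (m + 1) + 1) ^ (m + 2)} F canon perfect)

2∤[2^[m+1]+1]^k : ∀ m k → ¬ 2 ∣ (2 ^ (m + 1) + 1) ^ k
2∤[2^[m+1]+1]^k m =
  prime∤^ prime[2] (∣m⇒∤1+m (s≤s (s≤s z≤n)) (m∣m^n 2 (m≤n+m 1 m)) ∘ subst (2 ∣_) (+-comm _ 1))

2∤∏[1+a*2^L] : ∀ {L} → 1 ≤ L → ∀ as → ¬ 2 ∣ product (map (λ a → 1 + a * 2 ^ L) as)
2∤∏[1+a*2^L] 1≤L as = prime∤product prime[2]
  (All.map⁺ (All.universal (λ a → ∣m⇒∤1+m (s≤s (s≤s z≤n)) (∣n⇒∣m*n a (m∣m^n 2 1≤L))) as))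

-- Both sides of the exponent identity are split into a power of 2 times an odd number.
exponent-identity⇒exponents≡1 : ∀ m L {a as} → length as ≡ L → 1 ≤ L → All (1 ≤_) (a ∷ as) →
  2 ^ (m + 1) * (2 ^ (m + 1) + 1) ^ (m + 2) ≡ 2 ^ L * product (map (λ b → 1 + b * 2 ^ L) (a ∷ as)) →
  L ≡ m + 1 × All (_≡ 1) (a ∷ as)
exponent-identity⇒exponents≡1 m L {a} {as} refl 1≤L 1≤exponents eq
  with m+1≡L , Q≡D ← p^i*u≡p^j*v⇒i≡j×u≡v (m + 1) L (2∤[2^[m+1]+1]^k m (m + 2)) (2∤∏[1+a*2^L] 1≤L (a ∷ as)) eq
  = sym m+1≡L , ∏[1+a*B]≡[1+B]^length⇒a≡1 (2 ^ L) (a ∷ as) (m^n>0 2 L) 1≤exponents (trans (sym Q≡D)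
      (cong₂ _^_ (trans (+-comm _ 1) (cong (λ k → 1 + 2 ^ k) m+1≡L)) (trans (+-suc m 1) (cong suc m+1≡L))))

exponent-identity⇒prime-power : ∀ X {p a} → X ≡ 2 ^ 0 * product (map (λ b → 1 + b * 2 ^ 0) (a ∷ [])) →
                                expand ((p , a) ∷ []) ≡ p ^ (X ∸ 1)
exponent-identity⇒prime-power X {p} {a} eq = trans (*-identityʳ (p ^ a)) (cong (λ k → p ^ (k ∸ 1))
  (sym (trans eq (trans (*-identityˡ _) (trans (*-identityʳ _) (cong suc (*-identityʳ a)))))))

exponent-identity⇒distinctPrimeProduct : ∀ m {p a} F → Canonical ((p , a) ∷ F) → 1 ≤ length F →
  2 ^ (m + 1) * (2 ^ (m + 1) + 1) ^ (m + 2) ≡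
    2 ^ length F * product (map (λ b → 1 + b * 2 ^ length F) (a ∷ exponents F)) →
  DistinctPrimeProduct (m + 2) (expand ((p , a) ∷ F))
exponent-identity⇒distinctPrimeProduct m {p} {a} F canon 1≤L eq
  with F≡m+1 , ones ← exponent-identity⇒exponents≡1 m (length F) (length-map proj₂ F) 1≤L
                        (canonical⇒exponents≥1 (_ ∷ F) canon) eq
  = subst (λ k → DistinctPrimeProduct k (expand ((p , a) ∷ F))) (trans (cong suc F≡m+1) (sym (+-suc m 1)))
      (expand-distinctPrimeProduct (_ ∷ F) canon ones)

corollary3p11 : (m : ℕ) → m ≥ 1 → (n : ℕ) →
    IsKT₀T*Perfect (2 ^ m * (2 ^ (m + 1) + 1) ^ (m + 2)) n →
    (Σ ℕ λ p₁ → Prime p₁ × n ≡ p₁ ^ (2 ^ (m + 1) * (2 ^ (m + 1) + 1) ^ (m + 2) ∸ 1))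
    ⊎ (Σ (Fin (m + 2) → ℕ) λ p →
         ((i : Fin (m + 2)) → Prime (p i)) × Injective _≡_ _≡_ p × n ≡ product (toList p))
corollary3p11 m _ n perfect@(1<n , _) with canonicalFactorisation n {{>-nonZero (<-trans z<s 1<n)}}
... | [] , _ , refl = contradiction 1<n (<-irrefl refl)
... | (p , a) ∷ [] , canon@(p-prime , _) , refl =
  inj₁ (p , p-prime , exponent-identity⇒prime-power _ {a = a} (perfect⇒exponent-identity m [] canon perfect))
... | (p , a) ∷ F@(_ ∷ _) , canon , refl =
  inj₂ (exponent-identity⇒distinctPrimeProduct m F canon (s≤s z≤n)
          (perfect⇒exponent-identity m F canon perfect))
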